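{- Let $X$ be a string and $X[i\mathinner{.\,.} j]$ a fragment whose leftmost minimum is $X[j]$. Then $p$ is a CT-block-period of $X[i\mathinner{.\,.} j]$ if and only if $p$ is a period of the string $\mathsf{ND}(X)[i\mathinner{.\,.} j)=\mathsf{ND}(X)[i]\cdots\mathsf{ND}(X)[j-1]$ and $p$ divides $j-i+1$.
   Context: Strings are over a totally ordered alphabet; $X[i]$ is the $i$-th character (1-indexed); $X[i\mathinner{.\,.} j]$ denotes $X[i]\cdots X[j]$ and $X[i\mathinner{.\,.} j)$ denotes $X[i]\cdots X[j-1]$. An integer $p>0$ is a period of a string $S$ if $S[t]=S[t+p]$ for all $t\in[1,|S|-p]$. The leftmost minimum of a nonempty string $S$ is $S[t]$ for the smallest index $t$ at which the minimum value occurs. The Cartesian tree $\mathsf{CT}(S)$: empty for the empty string; otherwise a root with left subtree $\mathsf{CT}(S[1\mathinner{.\,.} t-1])$ and right subtree $\mathsf{CT}(S[t+1\mathinner{.\,.} |S|])$, where $S[t]$ is the leftmost minimum. $S\approx S'$ iff $\mathsf{CT}(S)=\mathsf{CT}(S')$. A string $S[1\mathinner{.\,.} \ell]$ has CT-border-period $p\in[1,\ell]$ iff $S[1\mathinner{.\,.} \ell-p]\approx S[p+1\mathinner{.\,.} \ell]$; it has CT-block-period $p$ iff $p$ divides $\ell$, $p$ is a CT-border-period of $S$, and the leftmost minimum of $S$ is $S[1]$ or $S[\ell]$. For a string $X$, $\mathsf{nsv}_X(i)=\min(\{j\in(i,|X|]: X[j]<X[i]\}\cup\{|X|+1\})$,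 and $\mathsf{ND}(X)$ is the length-$|X|$ integer string with $\mathsf{ND}(X)[i]=\mathsf{nsv}_X(i)-i$ if $\mathsf{nsv}_X(i)\neq|X|+1$ and $0$ otherwise. -}

module Defs where

open import Level using (Level)
open import Data.Nat using (ℕ; zero; suc; _+_; _∸_; _≤_; _<_)
open import Data.Nat.Divisibility using (_∣_)
open import Data.List using (List; []; _∷_; length; take; drop)
open import Data.Maybe using (Maybe; just; nothing)
open import Data.Product using (_×_)
open import Data.Sum using (_⊎_)
open import Relation.Nullary using (yes; no)
open import Relation.Binary.PropositionalEquality using (_≡_)
open import Relation.Binary.Bundles using (StrictTotalOrder)

-- 1-indexed character access: at S t = just S[t] for t ∈ [1,|S|], nothing otherwise
at : ∀ {a} {A : Set a} → List A → ℕ → Maybe A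
at []       _             = nothing
at (x ∷ xs) zero          = nothing
at (x ∷ xs) (suc zero)    = just x
at (x ∷ xs) (suc (suc t)) = at xs (suc t)

-- fragment X[i..j] (1-indexed, inclusive) and X[i..j) (exclusive)
frag : ∀ {a} {A : Set a} → List A → ℕ → ℕ → List A
frag X i j = take (suc j ∸ i) (drop (i ∸ 1) X)

fragEx : ∀ {a} {A : Set a} → List A → ℕ → ℕ → List A
fragEx X i j = take (j ∸ i) (drop (i ∸ 1) X)

IsPeriod : ∀ {a} {A : Set a} → List A → ℕ → Set a
IsPeriod S p = (0 < p) × (∀ t → 1 ≤ t → t ≤ length S ∸ p → at S t ≡ at S (t + p))

-- shapes of Cartesian trees
data Tree : Set where
  leaf : Tree
  node : Tree → Tree → Tree

module OrderedAlphabet {a ℓ₁ ℓ₂} (O : StrictTotalOrder a ℓ₁ ℓ₂) where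
  open StrictTotalOrder O renaming (Carrier to A)

  -- go m k c xs : m = current minimum value, k = its (1-indexed) position,
  -- c = position of the head of xs; returns position of the leftmost minimum
  private
    go : A → ℕ → ℕ → List A → ℕ
    go m k c []       = k
    go m k c (y ∷ ys) with y <? m
    ... | yes _ = go y c (suc c) ys
    ... | no  _ = go m k (suc c) ys

  -- 1-indexed position of the leftmost minimum of a string (0 for the empty string)
  lminPos : List A → ℕ
  lminPos []       = 0
  lminPos (x ∷ xs) = go x 1 2 xs

  private
    ctFuel : ℕ → List A → Tree
    ctFuel zero    _  = leaf
    ctFuel (suc f) [] = leaf
    ctFuel (suc f) S@(_ ∷ _) =
      node (ctFuel f (take (lminPos S ∸ 1) S)) (ctFuel f (drop (lminPos S) S))

  -- Cartesian tree CT(S) (fuel |S| suffices since each recursive call shrinks the string)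
  CT : List A → Tree
  CT S = ctFuel (length S) S

  _≈CT_ : List A → List A → Set
  S ≈CT S' = CT S ≡ CT S'

  IsCTBorderPeriod : List A → ℕ → Set
  IsCTBorderPeriod S p = (1 ≤ p) × (p ≤ length S) × (take (length S ∸ p) S ≈CT drop p S)

  IsCTBlockPeriod : List A → ℕ → Set
  IsCTBlockPeriod S p =
    (p ∣ length S) × IsCTBorderPeriod S p × ((lminPos S ≡ 1) ⊎ (lminPos S ≡ length S))

  private
    firstLess : A → ℕ → List A → ℕ
    firstLess x k []       = 0
    firstLess x k (y ∷ ys) with y <? x
    ... | yes _ = k
    ... | no  _ = firstLess x (suc k) ys

  -- ND(X)[i] = nsv_X(i) - i, or 0 when there is no next smaller value
  ND : List A → List ℕ
  ND []       = []
  ND (x ∷ xs) = firstLess x 1 xs ∷ ND xs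

{-# OPTIONS --safe #-}
-- The Cartesian tree and the ND array of a string are both determined by splitting the
-- string at its leftmost minimum, so S ≈ S′ iff ND(S) ≡ ND(S′).  Let S = X[i..j] end with
-- its minimum m and have length ℓ.  Every next smaller value of a position before m then
-- lies inside S, so ND(S) is ND(X)[i..j) followed by 0; passing to a prefix of S only
-- resets to 0 the offsets that leave the prefix.  The suffix S[p+1..ℓ] again ends with m,
-- so its offsets are nonzero except the last.  Hence S[1..ℓ−p] ≈ S[p+1..ℓ] iff no offset
-- of the prefix is reset and they agree with those of the suffix shifted by p, i.e. iff p
-- is a period of ND(X)[i..j).
module Submission where

open import Defs
open import Level using (_⊔_; 0ℓ)
open import Data.Bool using (if_then_else_; true; false)
open import Data.Empty using (⊥-elim)
open import Data.List using (List; []; _∷_; _++_; [_]; length; take; drop)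
open import Data.List.Properties
  using ( ∷-injectiveˡ; ∷-injectiveʳ; ∷ʳ-injectiveˡ; ++-assoc; ++-identityʳ
        ; length-++; length-take; length-drop; take-all; drop-all; take++drop≡id )
open import Data.List.Relation.Unary.All as All using (All; []; _∷_)
open import Data.List.Relation.Unary.All.Properties using (++⁺; drop⁺)
open import Data.Maybe using (nothing)
open import Data.Maybe.Properties using (just-injective)
open import Data.Nat using (ℕ; zero; suc; _+_; _∸_; _≤_; _<_; _<ᵇ_; z≤n; s≤s; _≤?_; _<?_)
open import Data.Nat.Properties
open import Data.Nat.Divisibility using (_∣_; ∣⇒≤)
open import Data.Product using (Σ; _×_; _,_; proj₁; proj₂)
open import Data.Sum using (inj₂)
open import Function.Base using (_∘_)
open import Function.Bundles using (_⇔_; mk⇔; Equivalence)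
open import Function.Properties.Equivalence using (⇔-setoid)
open import Relation.Nullary using (¬_; yes; no)
open import Relation.Binary.Bundles using (StrictTotalOrder)
open import Relation.Binary.Definitions using (tri<; tri≈; tri>)
open import Relation.Binary.PropositionalEquality
  using (_≡_; refl; sym; trans; cong; cong₂; subst; module ≡-Reasoning)
import Relation.Binary.Reasoning.Setoid as SetoidReasoning

module ⇔-Reasoning = SetoidReasoning (⇔-setoid 0ℓ)

module _ {a} {A : Set a} where

  length-++-[] : ∀ (xs : List A) {x} → length (xs ++ [ x ]) ≡ suc (length xs)
  length-++-[] xs = trans (length-++ xs) (+-comm (length xs) 1)

  take-length-++ : ∀ (xs : List A) {ys} → take (length xs) (xs ++ ys) ≡ xs
  take-length-++ []       = refl
  take-length-++ (x ∷ xs) = cong (x ∷_) (take-length-++ xs)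

  drop-suc-length-++ : ∀ (xs : List A) {y ys} → drop (suc (length xs)) (xs ++ y ∷ ys) ≡ ys
  drop-suc-length-++ []       = refl
  drop-suc-length-++ (x ∷ xs) = drop-suc-length-++ xs

  take-++ˡ : ∀ n (xs : List A) {ys} → n ≤ length xs → take n (xs ++ ys) ≡ take n xs
  take-++ˡ zero    xs       _         = refl
  take-++ˡ (suc n) (x ∷ xs) (s≤s n≤) = cong (x ∷_) (take-++ˡ n xs n≤)

  drop-++ˡ : ∀ n (xs : List A) {ys} → n ≤ length xs → drop n (xs ++ ys) ≡ drop n xs ++ ys
  drop-++ˡ zero    xs       _         = refl
  drop-++ˡ (suc n) (x ∷ xs) (s≤s n≤) = drop-++ˡ n xs n≤

  at-take : ∀ n (xs : List A) t → t < n → at (take n xs) (suc t) ≡ at xs (suc t)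
  at-take (suc n) []       t       _         = refl
  at-take (suc n) (x ∷ xs) zero    _         = refl
  at-take (suc n) (x ∷ xs) (suc t) (s≤s t<n) = at-take n xs t t<n

  at-drop : ∀ p (xs : List A) t → at (drop p xs) (suc t) ≡ at xs (suc t + p)
  at-drop zero    xs       t = cong (at xs) (sym (+-identityʳ (suc t)))
  at-drop (suc p) []       t = refl
  at-drop (suc p) (x ∷ xs) t rewrite +-suc t p = at-drop p xs t

  at-beyond : ∀ (xs : List A) t → length xs ≤ t → at xs (suc t) ≡ nothing
  at-beyond []       t       _          = refl
  at-beyond (x ∷ xs) (suc t) (s≤s |xs|≤t) = at-beyond xs t |xs|≤t

  at-ext : ∀ (xs ys : List A) → (∀ t → at xs (suc t) ≡ at ys (suc t)) → xs ≡ ys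
  at-ext []       []       _ = refl
  at-ext []       (y ∷ ys) h with () ← h 0
  at-ext (x ∷ xs) []       h with () ← h 0
  at-ext (x ∷ xs) (y ∷ ys) h = cong₂ _∷_ (just-injective (h 0)) (at-ext xs ys (λ t → h (suc t)))

  IsPeriod⇔border : ∀ (xs : List A) p → IsPeriod xs p ⇔ (0 < p × take (length xs ∸ p) xs ≡ drop p xs)
  IsPeriod⇔border xs p = mk⇔ to from
    where
    open ≡-Reasoning
    n = length xs ∸ p

    to : IsPeriod xs p → 0 < p × take n xs ≡ drop p xs
    to (0<p , period) = 0<p , at-ext _ _ pointwise
      where
      pointwise : ∀ t → at (take n xs) (suc t) ≡ at (drop p xs) (suc t)
      pointwise t with t <? n
      ... | yes t<n = begin
        at (take n xs) (suc t) ≡⟨ at-take n xs t t<n ⟩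
        at xs (suc t)          ≡⟨ period (suc t) (s≤s z≤n) t<n ⟩
        at xs (suc t + p)      ≡⟨ at-drop p xs t ⟨
        at (drop p xs) (suc t) ∎
      ... | no t≮n = trans (at-beyond (take n xs) t |take|≤t) (sym (at-beyond (drop p xs) t |drop|≤t))
        where
        |take|≤t = ≤-trans (≤-reflexive (length-take n xs)) (≤-trans (m⊓n≤m n _) (≮⇒≥ t≮n))
        |drop|≤t = ≤-trans (≤-reflexive (length-drop p xs)) (≮⇒≥ t≮n)

    from : 0 < p × take n xs ≡ drop p xs → IsPeriod xs p
    from (0<p , border) = 0<p , λ where
      (suc t) _ t<n → begin
        at xs (suc t)          ≡⟨ at-take n xs t t<n ⟨
        at (take n xs) (suc t) ≡⟨ cong (λ ys → at ys (suc t)) border ⟩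
        at (drop p xs) (suc t) ≡⟨ at-drop p xs t ⟩
        at xs (suc t + p)      ∎

clipOffset : ℕ → ℕ → ℕ
clipOffset n zero    = zero
clipOffset n (suc e) = if e <ᵇ n then suc e else zero

-- clip n (ND S) ≡ ND (take n S): an offset survives iff it stays inside the prefix.
clip : ℕ → List ℕ → List ℕ
clip zero    _        = []
clip (suc n) []       = []
clip (suc n) (d ∷ ds) = clipOffset n d ∷ clip n ds

clip-[] : ∀ n → clip n [] ≡ []
clip-[] zero    = refl
clip-[] (suc n) = refl

clip-drop : ∀ p n ds → drop p (clip n ds) ≡ clip (n ∸ p) (drop p ds)
clip-drop zero    n       ds       = refl
clip-drop (suc p) zero    ds       = refl
clip-drop (suc p) (suc n) []       = sym (clip-[] (n ∸ p))
clip-drop (suc p) (suc n) (d ∷ ds) = clip-drop p n ds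

clip-cut : ∀ n ds → n < length ds → clip (suc n) ds ≡ clip (suc n) (take n ds) ++ [ 0 ]
clip-cut zero    (zero  ∷ ds) _         = refl
clip-cut zero    (suc e ∷ ds) _         = refl
clip-cut (suc n) (d ∷ ds)     (s≤s n<) = cong (clipOffset (suc n) d ∷_) (clip-cut n ds n<)

clipOffset-positive : ∀ n d → 0 < clipOffset n d → clipOffset n d ≡ d
clipOffset-positive n (suc e) pos with e <ᵇ n
... | true  = refl
... | false = ⊥-elim (n≮0 pos)

clip-positive : ∀ n ds → length ds ≤ n → All (0 <_) (clip n ds) → clip n ds ≡ ds
clip-positive n       []       _         _          = clip-[] n
clip-positive (suc n) (d ∷ ds) (s≤s |ds|≤n) (pos ∷ poss) =
  cong₂ _∷_ (clipOffset-positive n d pos) (clip-positive n ds |ds|≤n poss)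

clip≡⇔≡ : ∀ n ds {ws} → All (0 <_) ws → clip n ws ≡ ws → length ds ≤ n →
          clip n ds ≡ ws ⇔ ds ≡ ws
clip≡⇔≡ n ds {ws} pos fixed |ds|≤n = mk⇔ to λ { refl → fixed }
  where
  to : clip n ds ≡ ws → ds ≡ ws
  to eq = trans (sym (clip-positive n ds |ds|≤n (subst (All (0 <_)) (sym eq) pos))) eq

clip-border⇔border : ∀ es p → All (0 <_) es → clip (suc (length es)) es ≡ es → 0 < p →
                     clip (suc (length es) ∸ p) (es ++ [ 0 ]) ≡ drop p (es ++ [ 0 ]) ⇔
                     take (length es ∸ p) es ≡ drop p es
clip-border⇔border es p pos fixed 0<p with p ≤? length es
... | no p≰ = mk⇔ (λ _ → trivialʳ) (λ _ → trivialˡ)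
  where
  |es|<p = ≰⇒> p≰
  trivialʳ : take (length es ∸ p) es ≡ drop p es
  trivialʳ rewrite m≤n⇒m∸n≡0 (<⇒≤ |es|<p) | drop-all p es (<⇒≤ |es|<p) = refl
  trivialˡ : clip (suc (length es) ∸ p) (es ++ [ 0 ]) ≡ drop p (es ++ [ 0 ])
  trivialˡ rewrite m≤n⇒m∸n≡0 |es|<p
                 | drop-all p (es ++ [ 0 ]) (≤-trans (≤-reflexive (length-++-[] es)) |es|<p) = refl
... | yes p≤ = let open ⇔-Reasoning in begin
  (clip (suc (length es) ∸ p) (es ++ [ 0 ]) ≡ drop p (es ++ [ 0 ]))
    ≡⟨ cong₂ _≡_ prefix (drop-++ˡ p es p≤) ⟩
  (clip (suc s) (take s es) ++ [ 0 ] ≡ drop p es ++ [ 0 ])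
    ≈⟨ mk⇔ (∷ʳ-injectiveˡ _ _) (cong (_++ [ 0 ])) ⟩
  (clip (suc s) (take s es) ≡ drop p es)
    ≈⟨ clip≡⇔≡ (suc s) (take s es) (drop⁺ p pos) suffix-fixed (m≤n⇒m≤1+n |take|≤s) ⟩
  (take s es ≡ drop p es) ∎
  where
  s = length es ∸ p
  |take|≤s : length (take s es) ≤ s
  |take|≤s = ≤-trans (≤-reflexive (length-take s es)) (m⊓n≤m s _)
  s< : s < length (es ++ [ 0 ])
  s< = ≤-trans (s≤s (m∸n≤m _ p)) (≤-reflexive (sym (length-++-[] es)))
  prefix : clip (suc (length es) ∸ p) (es ++ [ 0 ]) ≡ clip (suc s) (take s es) ++ [ 0 ]
  prefix = begin
    clip (suc (length es) ∸ p) (es ++ [ 0 ])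
      ≡⟨ cong (λ n → clip n (es ++ [ 0 ])) (+-∸-assoc 1 p≤) ⟩
    clip (suc s) (es ++ [ 0 ])
      ≡⟨ clip-cut s (es ++ [ 0 ]) s< ⟩
    clip (suc s) (take s (es ++ [ 0 ])) ++ [ 0 ]
      ≡⟨ cong (λ xs → clip (suc s) xs ++ [ 0 ]) (take-++ˡ s es (m∸n≤m _ p)) ⟩
    clip (suc s) (take s es) ++ [ 0 ]
      ∎
    where open ≡-Reasoning
  suffix-fixed : clip (suc s) (drop p es) ≡ drop p es
  suffix-fixed = begin
    clip (suc s) (drop p es)                ≡⟨ cong (λ n → clip n (drop p es)) (+-∸-assoc 1 p≤) ⟨
    clip (suc (length es) ∸ p) (drop p es)  ≡⟨ clip-drop p _ es ⟨
    drop p (clip (suc (length es)) es)      ≡⟨ cong (drop p) fixed ⟩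
    drop p es                               ∎
    where open ≡-Reasoning

closeOffset : ℕ → ℕ → ℕ
closeOffset n zero    = suc n
closeOffset n (suc e) = suc e

-- ND (L ++ [ m ]) without its final 0, when m lies below every letter of L:
-- every missing next smaller value becomes m.
closeND : List ℕ → List ℕ
closeND []       = []
closeND (d ∷ ds) = closeOffset (length ds) d ∷ closeND ds

length-closeND : ∀ ds → length (closeND ds) ≡ length ds
length-closeND []       = refl
length-closeND (d ∷ ds) = cong suc (length-closeND ds)

closeND-positive : ∀ ds → All (0 <_) (closeND ds)
closeND-positive []            = []
closeND-positive (zero  ∷ ds) = s≤s z≤n ∷ closeND-positive ds
closeND-positive (suc e ∷ ds) = s≤s z≤n ∷ closeND-positive ds

length-before-0 : ∀ us us′ {vs vs′} → All (0 <_) us → All (0 <_) us′ →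
                  us ++ 0 ∷ vs ≡ us′ ++ 0 ∷ vs′ → length us ≡ length us′
length-before-0 []       []         _          _           _  = refl
length-before-0 []       (_ ∷ _)    _          (pos′ ∷ _)  eq = ⊥-elim (<-irrefl (∷-injectiveˡ eq) pos′)
length-before-0 (_ ∷ _)  []         (pos ∷ _)  _           eq = ⊥-elim (<-irrefl (sym (∷-injectiveˡ eq)) pos)
length-before-0 (u ∷ us) (u′ ∷ us′) (_ ∷ poss) (_ ∷ poss′) eq =
  cong suc (length-before-0 us us′ poss poss′ (∷-injectiveʳ eq))

module _ {a ℓ₁ ℓ₂} (O : StrictTotalOrder a ℓ₁ ℓ₂) where
  open OrderedAlphabet O
  open StrictTotalOrder O using (compare; <-resp-≈)
    renaming (Carrier to A; _<_ to _≺_; _<?_ to _≺?_; trans to ≺-trans)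

  -- Defs keeps the workers of CT, lminPos and ND private.  Each is recovered as the
  -- solution of a metavariable by unfolding its public wrapper; the `with` turns the
  -- wrapper's fixed arguments into variables, so that unification faces a pattern.
  private
    mutual
      ctFuel : ℕ → List A → Tree
      ctFuel = _

      CT-unfold : ∀ S → CT S ≡ ctFuel (length S) S
      CT-unfold S with length S
      ... | n = refl

    mutual
      go : A → ℕ → ℕ → List A → ℕ
      go = _

      lminPos-unfold : ∀ x xs → lminPos (x ∷ xs) ≡ go x 1 2 xs
      lminPos-unfold x xs with 2 | 1
      ... | c | k = refl

    mutual
      firstLess : A → ℕ → List A → ℕ
      firstLess = _

      ND-unfold : ∀ x xs → ND (x ∷ xs) ≡ firstLess x 1 xs ∷ ND xs
      ND-unfold x xs with 1
      ... | k = refl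

  ≺-≮-trans : ∀ {x y z} → x ≺ y → ¬ z ≺ y → x ≺ z
  ≺-≮-trans {y = y} {z} x≺y z⊀y with compare y z
  ... | tri< y≺z _ _ = ≺-trans x≺y y≺z
  ... | tri≈ _ y≈z _ = proj₁ <-resp-≈ y≈z x≺y
  ... | tri> _ _ z≺y = ⊥-elim (z⊀y z≺y)

  sucOffset : ℕ → ℕ
  sucOffset zero    = zero
  sucOffset (suc d) = suc (suc d)

  nsvOffset : A → List A → ℕ
  nsvOffset x []       = 0
  nsvOffset x (y ∷ ys) with y ≺? x
  ... | yes _ = 1
  ... | no  _ = sucOffset (nsvOffset x ys)

  firstLess-suc : ∀ x k ys → firstLess x (suc (suc k)) ys ≡ sucOffset (firstLess x (suc k) ys)
  firstLess-suc x k []       = refl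
  firstLess-suc x k (y ∷ ys) with y ≺? x
  ... | yes _ = refl
  ... | no  _ = firstLess-suc x (suc k) ys

  firstLess≡nsvOffset : ∀ x ys → firstLess x 1 ys ≡ nsvOffset x ys
  firstLess≡nsvOffset x []       = refl
  firstLess≡nsvOffset x (y ∷ ys) with y ≺? x
  ... | yes _ = refl
  ... | no  _ = trans (firstLess-suc x 0 ys) (cong sucOffset (firstLess≡nsvOffset x ys))

  ND-∷ : ∀ x xs → ND (x ∷ xs) ≡ nsvOffset x xs ∷ ND xs
  ND-∷ x xs = trans (ND-unfold x xs) (cong (_∷ ND xs) (firstLess≡nsvOffset x xs))

  length-ND : ∀ S → length (ND S) ≡ length S
  length-ND []       = refl
  length-ND (x ∷ xs) = trans (cong length (ND-∷ x xs)) (cong suc (length-ND xs))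

  ND-drop : ∀ n S → ND (drop n S) ≡ drop n (ND S)
  ND-drop zero    S        = refl
  ND-drop (suc n) []       = refl
  ND-drop (suc n) (x ∷ xs) = trans (ND-drop n xs) (cong (drop (suc n)) (sym (ND-∷ x xs)))

  clipOffset-zero : ∀ d → clipOffset 0 d ≡ 0
  clipOffset-zero zero    = refl
  clipOffset-zero (suc e) = refl

  clipOffset-suc : ∀ n d → clipOffset (suc n) (sucOffset d) ≡ sucOffset (clipOffset n d)
  clipOffset-suc n zero    = refl
  clipOffset-suc n (suc e) with e <ᵇ n
  ... | true  = refl
  ... | false = refl

  nsvOffset-take : ∀ x n ys → nsvOffset x (take n ys) ≡ clipOffset n (nsvOffset x ys)
  nsvOffset-take x zero    ys       = sym (clipOffset-zero (nsvOffset x ys))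
  nsvOffset-take x (suc n) []       = refl
  nsvOffset-take x (suc n) (y ∷ ys) with y ≺? x
  ... | yes _ = refl
  ... | no  _ = trans (cong sucOffset (nsvOffset-take x n ys))
                      (sym (clipOffset-suc n (nsvOffset x ys)))

  ND-take : ∀ n S → ND (take n S) ≡ clip n (ND S)
  ND-take zero    S        = refl
  ND-take (suc n) []       = refl
  ND-take (suc n) (x ∷ xs) = begin
    ND (x ∷ take n xs)
      ≡⟨ ND-∷ x (take n xs) ⟩
    nsvOffset x (take n xs) ∷ ND (take n xs)
      ≡⟨ cong₂ _∷_ (nsvOffset-take x n xs) (ND-take n xs) ⟩
    clipOffset n (nsvOffset x xs) ∷ clip n (ND xs)
      ≡⟨ cong (clip (suc n)) (ND-∷ x xs) ⟨
    clip (suc n) (ND (x ∷ xs))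
      ∎
    where open ≡-Reasoning

  closeOffset-suc : ∀ n d → closeOffset (suc n) (sucOffset d) ≡ sucOffset (closeOffset n d)
  closeOffset-suc n zero    = refl
  closeOffset-suc n (suc e) = refl

  nsvOffset-below : ∀ {m x} → m ≺ x → ∀ L {R} →
                    nsvOffset x (L ++ m ∷ R) ≡ closeOffset (length L) (nsvOffset x L)
  nsvOffset-below {m} {x} m≺x [] with m ≺? x
  ... | yes _   = refl
  ... | no  m⊀x = ⊥-elim (m⊀x m≺x)
  nsvOffset-below {x = x} m≺x (y ∷ L) with y ≺? x
  ... | yes _ = refl
  ... | no  _ = trans (cong sucOffset (nsvOffset-below m≺x L))
                      (sym (closeOffset-suc (length L) (nsvOffset x L)))

  nsvOffset-none : ∀ {x ys} → All (λ y → ¬ y ≺ x) ys → nsvOffset x ys ≡ 0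
  nsvOffset-none {x} {[]}     []             = refl
  nsvOffset-none {x} {y ∷ ys} (y⊀x ∷ ys⊀x) with y ≺? x
  ... | yes y≺x = ⊥-elim (y⊀x y≺x)
  ... | no  _   = cong sucOffset (nsvOffset-none ys⊀x)

  ND-below : ∀ {m L R} → All (m ≺_) L → ND (L ++ m ∷ R) ≡ closeND (ND L) ++ ND (m ∷ R)
  ND-below {m} {[]}    []             = refl
  ND-below {m} {x ∷ L} {R} (m≺x ∷ m≺L) = begin
    ND (x ∷ L ++ m ∷ R)
      ≡⟨ ND-∷ x (L ++ m ∷ R) ⟩
    nsvOffset x (L ++ m ∷ R) ∷ ND (L ++ m ∷ R)
      ≡⟨ cong₂ _∷_ (nsvOffset-below m≺x L) (ND-below m≺L) ⟩
    closeOffset (length L) (nsvOffset x L) ∷ rest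
      ≡⟨ cong (λ n → closeOffset n (nsvOffset x L) ∷ rest) (length-ND L) ⟨
    closeND (nsvOffset x L ∷ ND L) ++ ND (m ∷ R)
      ≡⟨ cong (λ ds → closeND ds ++ ND (m ∷ R)) (ND-∷ x L) ⟨
    closeND (ND (x ∷ L)) ++ ND (m ∷ R)
      ∎
    where
    open ≡-Reasoning
    rest = closeND (ND L) ++ ND (m ∷ R)

  ND-min : ∀ {m R} → All (λ y → ¬ y ≺ m) R → ND (m ∷ R) ≡ 0 ∷ ND R
  ND-min {m} {R} R⊀m = trans (ND-∷ m R) (cong (_∷ ND R) (nsvOffset-none R⊀m))

  record MinSplit (S : List A) : Set (a ⊔ ℓ₂) where
    constructor minSplitOf
    field
      left    : List A
      minimum : A
      right   : List A
      split   : S ≡ left ++ minimum ∷ right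
      minimum≺left  : All (minimum ≺_) left
      right⊀minimum : All (λ y → ¬ y ≺ minimum) right

  open MinSplit

  MinSplit-cast : ∀ {S S′} → S ≡ S′ → MinSplit S → MinSplit S′
  MinSplit-cast eq σ =
    minSplitOf (left σ) (minimum σ) (right σ) (trans (sym eq) (split σ)) (minimum≺left σ) (right⊀minimum σ)

  ≺-minimum⇒≺-all : ∀ {y S} (σ : MinSplit S) → y ≺ minimum σ → All (y ≺_) S
  ≺-minimum⇒≺-all σ y≺m = subst (All _) (sym (split σ))
    (++⁺ (All.map (≺-trans y≺m) (minimum≺left σ))
         (y≺m ∷ All.map (≺-≮-trans y≺m) (right⊀minimum σ)))

  go-spec : ∀ {P} (σ : MinSplit P) ys {k c} → k ≡ suc (length (left σ)) → c ≡ suc (length P) →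
            Σ (MinSplit (P ++ ys)) λ τ → go (minimum σ) k c ys ≡ suc (length (left τ))
  go-spec {P} σ [] k≡ _ = MinSplit-cast (sym (++-identityʳ P)) σ , k≡
  go-spec {P} σ (y ∷ ys) k≡ c≡ with y ≺? minimum σ
  ... | yes y≺m =
    let τ , eq = go-spec (minSplitOf P y [] refl (≺-minimum⇒≺-all σ y≺m) []) ys c≡ c≡′
    in MinSplit-cast (++-assoc P [ y ] ys) τ , eq
    where c≡′ = cong suc (trans c≡ (sym (length-++-[] P)))
  ... | no y⊀m =
    let τ , eq = go-spec σ′ ys k≡ (cong suc (trans c≡ (sym (length-++-[] P))))
    in MinSplit-cast (++-assoc P [ y ] ys) τ , eq
    where
    σ′ : MinSplit (P ++ [ y ])
    σ′ = minSplitOf (left σ) (minimum σ) (right σ ++ [ y ])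
           (trans (cong (_++ [ y ]) (split σ)) (++-assoc (left σ) (minimum σ ∷ right σ) [ y ]))
           (minimum≺left σ) (++⁺ (right⊀minimum σ) (y⊀m ∷ []))

  lminPos-spec : ∀ x xs → Σ (MinSplit (x ∷ xs)) λ σ → lminPos (x ∷ xs) ≡ suc (length (left σ))
  lminPos-spec x xs =
    let σ , eq = go-spec (minSplitOf [] x [] refl [] []) xs refl refl
    in σ , trans (lminPos-unfold x xs) eq

  minSplit : ∀ x xs → MinSplit (x ∷ xs)
  minSplit x xs = proj₁ (lminPos-spec x xs)

  length-left+right : ∀ x xs → length xs ≡ length (left (minSplit x xs)) + length (right (minSplit x xs))
  length-left+right x xs = suc-injective (begin
    suc (length xs)                       ≡⟨ cong length (split σ) ⟩
    length (left σ ++ minimum σ ∷ right σ) ≡⟨ length-++ (left σ) ⟩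
    length (left σ) + suc (length (right σ)) ≡⟨ +-suc _ _ ⟩
    suc (length (left σ) + length (right σ)) ∎)
    where
    open ≡-Reasoning
    σ = minSplit x xs

  left-shorter : ∀ x xs → length (left (minSplit x xs)) ≤ length xs
  left-shorter x xs = ≤-trans (m≤m+n _ _) (≤-reflexive (sym (length-left+right x xs)))

  right-shorter : ∀ x xs → length (right (minSplit x xs)) ≤ length xs
  right-shorter x xs = ≤-trans (m≤n+m _ _) (≤-reflexive (sym (length-left+right x xs)))

  ctFuel-[] : ∀ f → ctFuel f [] ≡ leaf
  ctFuel-[] zero    = refl
  ctFuel-[] (suc f) = refl

  ctFuel-split : ∀ f x xs → let σ = minSplit x xs in
                 ctFuel (suc f) (x ∷ xs) ≡ node (ctFuel f (left σ)) (ctFuel f (right σ))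
  ctFuel-split f x xs = cong₂ node (cong (ctFuel f) left≡) (cong (ctFuel f) right≡)
    where
    σ = minSplit x xs
    position = proj₂ (lminPos-spec x xs)
    left≡ : take (lminPos (x ∷ xs) ∸ 1) (x ∷ xs) ≡ left σ
    left≡ = trans (cong₂ (λ n S → take (n ∸ 1) S) position (split σ)) (take-length-++ (left σ))
    right≡ : drop (lminPos (x ∷ xs)) (x ∷ xs) ≡ right σ
    right≡ = trans (cong₂ drop position (split σ)) (drop-suc-length-++ (left σ))

  ctFuel-irrelevant : ∀ f g S → length S ≤ f → length S ≤ g → ctFuel f S ≡ ctFuel g S
  ctFuel-irrelevant f       g       []       _          _          = trans (ctFuel-[] f) (sym (ctFuel-[] g))
  ctFuel-irrelevant (suc f) (suc g) (x ∷ xs) (s≤s |xs|≤f) (s≤s |xs|≤g) = begin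
    ctFuel (suc f) (x ∷ xs)                        ≡⟨ ctFuel-split f x xs ⟩
    node (ctFuel f (left σ)) (ctFuel f (right σ))  ≡⟨ cong₂ node (on (left-shorter x xs))
                                                                  (on (right-shorter x xs)) ⟩
    node (ctFuel g (left σ)) (ctFuel g (right σ))  ≡⟨ ctFuel-split g x xs ⟨
    ctFuel (suc g) (x ∷ xs)                        ∎
    where
    open ≡-Reasoning
    σ = minSplit x xs
    on : ∀ {T} → length T ≤ length xs → ctFuel f T ≡ ctFuel g T
    on shorter = ctFuel-irrelevant f g _ (≤-trans shorter |xs|≤f) (≤-trans shorter |xs|≤g)

  CT-split : ∀ x xs → let σ = minSplit x xs in CT (x ∷ xs) ≡ node (CT (left σ)) (CT (right σ))
  CT-split x xs = begin
    CT (x ∷ xs)                                                ≡⟨ CT-unfold (x ∷ xs) ⟩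
    ctFuel (suc (length xs)) (x ∷ xs)                          ≡⟨ ctFuel-split (length xs) x xs ⟩
    node (ctFuel (length xs) (left σ)) (ctFuel (length xs) (right σ))
      ≡⟨ cong₂ node (ctFuel-irrelevant _ _ _ (left-shorter x xs) ≤-refl)
                    (ctFuel-irrelevant _ _ _ (right-shorter x xs) ≤-refl) ⟩
    node (ctFuel (length (left σ)) (left σ)) (ctFuel (length (right σ)) (right σ))
      ≡⟨ cong₂ node (CT-unfold (left σ)) (CT-unfold (right σ)) ⟨
    node (CT (left σ)) (CT (right σ))                          ∎
    where
    open ≡-Reasoning
    σ = minSplit x xs

  ND-split : ∀ {S} (σ : MinSplit S) → ND S ≡ closeND (ND (left σ)) ++ 0 ∷ ND (right σ)
  ND-split σ = trans (cong ND (split σ))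
    (trans (ND-below (minimum≺left σ)) (cong (closeND (ND (left σ)) ++_) (ND-min (right⊀minimum σ))))

  ND-left : ∀ {S} (σ : MinSplit S) → ND (left σ) ≡ clip (length (left σ)) (ND S)
  ND-left {S} σ = trans (cong ND (sym left≡)) (ND-take n S)
    where
    n = length (left σ)
    left≡ = trans (cong (take n) (split σ)) (take-length-++ (left σ))

  ND-right : ∀ {S} (σ : MinSplit S) → ND (right σ) ≡ drop (suc (length (left σ))) (ND S)
  ND-right {S} σ = trans (cong ND (sym right≡)) (ND-drop n S)
    where
    n = suc (length (left σ))
    right≡ = trans (cong (drop n) (split σ)) (drop-suc-length-++ (left σ))

  ND≡⇒length-left≡ : ∀ {S S′} (σ : MinSplit S) (σ′ : MinSplit S′) →
                     ND S ≡ ND S′ → length (left σ) ≡ length (left σ′)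
  ND≡⇒length-left≡ σ σ′ eq = begin
    length (left σ)                  ≡⟨ length-ND (left σ) ⟨
    length (ND (left σ))             ≡⟨ length-closeND (ND (left σ)) ⟨
    length (closeND (ND (left σ)))   ≡⟨ length-before-0 _ _ (closeND-positive _) (closeND-positive _)
                                          (trans (sym (ND-split σ)) (trans eq (ND-split σ′))) ⟩
    length (closeND (ND (left σ′)))  ≡⟨ length-closeND (ND (left σ′)) ⟩
    length (ND (left σ′))            ≡⟨ length-ND (left σ′) ⟩
    length (left σ′)                 ∎
    where open ≡-Reasoning

  node-injective : ∀ {l r l′ r′} → node l r ≡ node l′ r′ → l ≡ l′ × r ≡ r′
  node-injective refl = refl , refl

  ≈CT⇔ND≡ : ∀ S S′ → S ≈CT S′ ⇔ ND S ≡ ND S′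
  ≈CT⇔ND≡ S S′ = bounded (length S) S S′ ≤-refl
    where
    bounded : ∀ n S S′ → length S ≤ n → S ≈CT S′ ⇔ ND S ≡ ND S′
    bounded _       []       []         _            = mk⇔ (λ _ → refl) (λ _ → refl)
    bounded _       []       (_ ∷ _)    _            = mk⇔ (λ ()) (λ ())
    bounded _       (_ ∷ _)  []         _            = mk⇔ (λ ()) (λ ())
    bounded (suc n) (x ∷ xs) (x′ ∷ xs′) (s≤s |xs|≤n) = mk⇔ to from
      where
      open ≡-Reasoning
      σ  = minSplit x xs
      σ′ = minSplit x′ xs′
      onLeft  = bounded n (left σ)  (left σ′)  (≤-trans (left-shorter x xs) |xs|≤n)
      onRight = bounded n (right σ) (right σ′) (≤-trans (right-shorter x xs) |xs|≤n)

      to : (x ∷ xs) ≈CT (x′ ∷ xs′) → ND (x ∷ xs) ≡ ND (x′ ∷ xs′)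
      to eq = begin
        ND (x ∷ xs)                                        ≡⟨ ND-split σ ⟩
        closeND (ND (left σ)) ++ 0 ∷ ND (right σ)          ≡⟨ cong₂ (λ l r → closeND l ++ 0 ∷ r)
                                                                (Equivalence.to onLeft  (proj₁ children))
                                                                (Equivalence.to onRight (proj₂ children)) ⟩
        closeND (ND (left σ′)) ++ 0 ∷ ND (right σ′)        ≡⟨ ND-split σ′ ⟨
        ND (x′ ∷ xs′)                                      ∎
        where children = node-injective (trans (sym (CT-split x xs)) (trans eq (CT-split x′ xs′)))

      from : ND (x ∷ xs) ≡ ND (x′ ∷ xs′) → (x ∷ xs) ≈CT (x′ ∷ xs′)
      from eq = begin
        CT (x ∷ xs)                        ≡⟨ CT-split x xs ⟩
        node (CT (left σ)) (CT (right σ))  ≡⟨ cong₂ node (Equivalence.from onLeft leftND)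
                                                          (Equivalence.from onRight rightND) ⟩
        node (CT (left σ′)) (CT (right σ′)) ≡⟨ CT-split x′ xs′ ⟨
        CT (x′ ∷ xs′)                      ∎
        where
        |left|≡ = ND≡⇒length-left≡ σ σ′ eq
        leftND : ND (left σ) ≡ ND (left σ′)
        leftND = trans (ND-left σ) (trans (cong₂ clip |left|≡ eq) (sym (ND-left σ′)))
        rightND : ND (right σ) ≡ ND (right σ′)
        rightND = trans (ND-right σ) (trans (cong₂ drop (cong suc |left|≡) eq) (sym (ND-right σ′)))

  border-≈CT⇔border : ∀ {L m p} → All (m ≺_) L → 0 < p →
    let S = L ++ [ m ]; E = closeND (ND L) in
    take (length S ∸ p) S ≈CT drop p S ⇔ take (length E ∸ p) E ≡ drop p E
  border-≈CT⇔border {L} {m} {p} m≺L 0<p = let open ⇔-Reasoning in begin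
    (take (length S ∸ p) S ≈CT drop p S)
      ≈⟨ ≈CT⇔ND≡ _ _ ⟩
    (ND (take (length S ∸ p) S) ≡ ND (drop p S))
      ≡⟨ cong₂ _≡_ (ND-take _ S) (ND-drop p S) ⟩
    (clip (length S ∸ p) (ND S) ≡ drop p (ND S))
      ≡⟨ cong₂ (λ n D → clip (n ∸ p) D ≡ drop p D) |S|≡ ND-S ⟩
    (clip (suc (length E) ∸ p) (E ++ [ 0 ]) ≡ drop p (E ++ [ 0 ]))
      ≈⟨ clip-border⇔border E p (closeND-positive (ND L)) E-fixed 0<p ⟩
    (take (length E ∸ p) E ≡ drop p E) ∎
    where
    S = L ++ [ m ]
    E = closeND (ND L)
    ND-S : ND S ≡ E ++ [ 0 ]
    ND-S = ND-below m≺L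
    |S|≡ : length S ≡ suc (length E)
    |S|≡ = trans (length-++-[] L) (cong suc (sym (trans (length-closeND (ND L)) (length-ND L))))
    E-fixed : clip (suc (length E)) E ≡ E
    E-fixed = ∷ʳ-injectiveˡ _ _ (begin
      clip (suc (length E)) E ++ [ 0 ]
        ≡⟨ cong (λ es → clip (suc (length E)) es ++ [ 0 ]) (take-length-++ E) ⟨
      clip (suc (length E)) (take (length E) (E ++ [ 0 ])) ++ [ 0 ]
        ≡⟨ clip-cut (length E) (E ++ [ 0 ]) (≤-reflexive (sym (length-++-[] E))) ⟨
      clip (suc (length E)) (E ++ [ 0 ])
        ≡⟨ cong₂ clip |S|≡ ND-S ⟨
      clip (length S) (ND S)
        ≡⟨ ND-take (length S) S ⟨
      ND (take (length S) S)
        ≡⟨ cong ND (take-all (length S) S ≤-refl) ⟩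
      ND S
        ≡⟨ ND-S ⟩
      E ++ [ 0 ] ∎)
      where open ≡-Reasoning

  CTBlockPeriod-minLast⇔period : ∀ {L m p} → All (m ≺_) L → lminPos (L ++ [ m ]) ≡ suc (length L) →
    IsCTBlockPeriod (L ++ [ m ]) p ⇔ (IsPeriod (closeND (ND L)) p × p ∣ suc (length L))
  CTBlockPeriod-minLast⇔period {L} {m} {p} m≺L position = mk⇔ to from
    where
    S = L ++ [ m ]
    E = closeND (ND L)
    |S|≡ : length S ≡ suc (length L)
    |S|≡ = length-++-[] L

    to : IsCTBlockPeriod S p → IsPeriod E p × p ∣ suc (length L)
    to (p∣|S| , (0<p , _ , border) , _) =
      Equivalence.from (IsPeriod⇔border E p) (0<p , Equivalence.to (border-≈CT⇔border m≺L 0<p) border) ,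
      subst (p ∣_) |S|≡ p∣|S|

    from : IsPeriod E p × p ∣ suc (length L) → IsCTBlockPeriod S p
    from (period , p∣) =
      let 0<p , border = Equivalence.to (IsPeriod⇔border E p) period in
      subst (p ∣_) (sym |S|≡) p∣ ,
      (0<p , subst (p ≤_) (sym |S|≡) (∣⇒≤ p∣) , Equivalence.from (border-≈CT⇔border m≺L 0<p) border) ,
      inj₂ (trans position (sym |S|≡))

  CTBlockPeriod-prefix⇔ND-period : ∀ Y q p → lminPos (take (suc q) Y) ≡ suc q →
    IsCTBlockPeriod (take (suc q) Y) p ⇔ (IsPeriod (take q (ND Y)) p × p ∣ suc q)
  CTBlockPeriod-prefix⇔ND-period []      q p ()
  CTBlockPeriod-prefix⇔ND-period (y ∷ Y) q p lastMin = let open ⇔-Reasoning in begin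
    IsCTBlockPeriod (y ∷ take q Y) p
      ≡⟨ cong (λ S → IsCTBlockPeriod S p) S≡ ⟩
    IsCTBlockPeriod (L ++ [ m ]) p
      ≈⟨ CTBlockPeriod-minLast⇔period (minimum≺left σ) (trans (cong lminPos (sym S≡)) position) ⟩
    (IsPeriod (closeND (ND L)) p × p ∣ suc (length L))
      ≡⟨ cong₂ (λ E n → IsPeriod E p × p ∣ suc n) E≡ |L|≡q ⟩
    (IsPeriod (take q (ND (y ∷ Y))) p × p ∣ suc q) ∎
    where
    σ = minSplit y (take q Y)
    position = proj₂ (lminPos-spec y (take q Y))
    L = left σ
    m = minimum σ
    E = closeND (ND L)
    Z = drop (suc q) (y ∷ Y)

    |L|≡q : length L ≡ q
    |L|≡q = suc-injective (trans (sym position) lastMin)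

    right≡[] : right σ ≡ []
    right≡[] = begin
      right σ                                   ≡⟨ drop-suc-length-++ L ⟨
      drop (suc (length L)) (L ++ m ∷ right σ)  ≡⟨ cong₂ (drop ∘ suc) |L|≡q (sym (split σ)) ⟩
      drop (suc q) (y ∷ take q Y)               ≡⟨ drop-all (suc q) (y ∷ take q Y) (s≤s |take|≤q) ⟩
      []                                        ∎
      where
      open ≡-Reasoning
      |take|≤q : length (take q Y) ≤ q
      |take|≤q = ≤-trans (≤-reflexive (length-take q Y)) (m⊓n≤m q (length Y))

    S≡ : y ∷ take q Y ≡ L ++ [ m ]
    S≡ = trans (split σ) (cong (λ R → L ++ m ∷ R) right≡[])

    E≡ : E ≡ take q (ND (y ∷ Y))
    E≡ = sym (begin
      take q (ND (y ∷ Y))               ≡⟨ cong (take q ∘ ND) (take++drop≡id (suc q) (y ∷ Y)) ⟨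
      take q (ND ((y ∷ take q Y) ++ Z)) ≡⟨ cong (λ S → take q (ND (S ++ Z))) S≡ ⟩
      take q (ND ((L ++ [ m ]) ++ Z))   ≡⟨ cong (take q ∘ ND) (++-assoc L [ m ] Z) ⟩
      take q (ND (L ++ m ∷ Z))          ≡⟨ cong (take q) (ND-below (minimum≺left σ)) ⟩
      take q (E ++ ND (m ∷ Z))          ≡⟨ cong (λ n → take n (E ++ ND (m ∷ Z))) |E|≡q ⟨
      take (length E) (E ++ ND (m ∷ Z)) ≡⟨ take-length-++ E ⟩
      E                                 ∎)
      where
      open ≡-Reasoning
      |E|≡q : length E ≡ q
      |E|≡q = trans (length-closeND (ND L)) (trans (length-ND L) |L|≡q)

lemma36 : ∀ {a ℓ₁ ℓ₂} (O : StrictTotalOrder a ℓ₁ ℓ₂) →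
          let open OrderedAlphabet O in
          ∀ (X : List (StrictTotalOrder.Carrier O)) (i j p : ℕ) → 1 ≤ i → i ≤ j → j ≤ length X →
          lminPos (frag X i j) ≡ suc j ∸ i →
          IsCTBlockPeriod (frag X i j) p ⇔ (IsPeriod (fragEx (ND X) i j) p × (p ∣ suc j ∸ i))
lemma36 O X (suc i) (suc j) p _ (s≤s i≤j) _ lastMin
  rewrite +-∸-assoc 1 i≤j | sym (ND-drop O i X) =
  CTBlockPeriod-prefix⇔ND-period O (drop i X) (j ∸ i) p lastMin
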